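{- Let $z:[n]\to[k]$ be any map. Then $\mathcal M_{n,z}:=\{\gamma\in\ker_{\mathbb Z}A_{n,z}:\|\gamma\|_1=4\}$ equals the set of all vectors $[u\,v\,u'\,v']$, where $u,v,u',v'\in[n]$ are distinct and $z(u)=z(u')$ or $z(v)=z(v')$. Here $[u\,v\,u'\,v']\in\mathbb Z^{\binom n2}$ denotes the vector with entries $+1$ at $\{u,v\}$ and $\{u',v'\}$, $-1$ at $\{v,u'\}$ and $\{v',u\}$, and $0$ elsewhere (a 4-cycle with alternating signs).
   Context: Coordinates of $\mathbb Z^{\binom n2}$ are indexed by 2-subsets $\{u,v\}$ of $[n]$. $A_{n,z}$ is the matrix obtained by stacking the $n\times\binom n2$ vertex-edge incidence matrix of $K_n$ on top of the $\binom{k+1}2\times\binom n2$ matrix whose rows are indexed by pairs $(i,j)$, $1\le i\le j\le k$, and whose column $\{u,v\}$ has a single $1$ in row $(\min(z(u),z(v)),\max(z(u),z(v)))$ and zeros elsewhere. -}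

module Defs where

open import Data.Nat using (ℕ)
open import Data.Fin using (Fin; _<_; _≤_)
open import Data.Fin.Properties using (_<?_; _≤?_; _≟_)
open import Data.Integer using (ℤ; +_; _+_; _-_; ∣_∣)
open import Data.List using (List; allFin; foldr; map)
open import Data.Product using (Σ; Σ-syntax; _×_; _,_; ∃-syntax)
open import Data.Sum using (_⊎_)
open import Relation.Nullary using (¬_; yes; no; Dec)
open import Relation.Binary.PropositionalEquality using (_≡_)
open import Function.Bundles using (_⇔_)

-- Coordinates of ℤ^(n choose 2): 2-subsets {a,b} of [n], encoded as a < b.
Edge : ℕ → Set
Edge n = Σ[ a ∈ Fin n ] Σ[ b ∈ Fin n ] a < b

ZVec : ℕ → Set
ZVec n = Edge n → ℤ

sumℤ : List ℤ → ℤ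
sumℤ = foldr _+_ (+ 0)

edgeSum : ∀ {n} → (Edge n → ℤ) → ℤ
edgeSum {n} f = sumℤ (map (λ a → sumℤ (map (λ b → term a b (a <? b)) (allFin n))) (allFin n))
  where
  term : (a b : Fin n) → Dec (a < b) → ℤ
  term a b (yes p) = f (a , b , p)
  term a b (no _)  = + 0

restrict : ∀ {n} (P : Edge n → Set) → ((e : Edge n) → Dec (P e)) → ZVec n → ZVec n
restrict P P? γ e with P? e
... | yes _ = γ e
... | no _  = + 0

incident : ∀ {n} → Fin n → Edge n → Set
incident w (a , b , _) = (w ≡ a) ⊎ (w ≡ b)

incident? : ∀ {n} (w : Fin n) (e : Edge n) → Dec (incident w e)
incident? w (a , b , _) with w ≟ a | w ≟ b
... | yes p | _ = yes (Data.Sum.inj₁ p)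
... | no _ | yes q = yes (Data.Sum.inj₂ q)
... | no p | no q = no λ { (Data.Sum.inj₁ x) → p x ; (Data.Sum.inj₂ y) → q y }

minF maxF : ∀ {k} → Fin k → Fin k → Fin k
minF x y with x ≤? y
... | yes _ = x
... | no _  = y
maxF x y with x ≤? y
... | yes _ = y
... | no _  = x

-- column {a,b} of the lower block has its 1 in row (i,j) = (min(z a,z b), max(z a,z b))
inRow : ∀ {n k} → (Fin n → Fin k) → Fin k → Fin k → Edge n → Set
inRow z i j (a , b , _) = (minF (z a) (z b) ≡ i) × (maxF (z a) (z b) ≡ j)

inRow? : ∀ {n k} (z : Fin n → Fin k) (i j : Fin k) (e : Edge n) → Dec (inRow z i j e)
inRow? z i j (a , b , _) with minF (z a) (z b) ≟ i | maxF (z a) (z b) ≟ j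
... | yes p | yes q = yes (p , q)
... | no p | _ = no λ { (x , _) → p x }
... | yes _ | no q = no λ { (_ , y) → q y }

-- γ ∈ ker_ℤ A_{n,z}: every row of A_{n,z} has zero inner product with γ
InKernel : ∀ {n k} → (Fin n → Fin k) → ZVec n → Set
InKernel {n} {k} z γ =
  ((w : Fin n) → edgeSum (restrict (incident w) (incident? w) γ) ≡ + 0)
  × ((i j : Fin k) → i ≤ j → edgeSum (restrict (inRow z i j) (inRow? z i j) γ) ≡ + 0)

l1norm : ∀ {n} → ZVec n → ℕ
l1norm γ = ∣ edgeSum (λ e → + ∣ γ e ∣) ∣

InM : ∀ {n k} → (Fin n → Fin k) → ZVec n → Set
InM z γ = InKernel z γ × (l1norm γ ≡ 4)

isPair : ∀ {n} → Fin n → Fin n → Edge n → ℤ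
isPair x y (a , b , _) with a ≟ x | b ≟ y | a ≟ y | b ≟ x
... | yes _ | yes _ | _ | _ = + 1
... | _ | _ | yes _ | yes _ = + 1
... | _ | _ | _ | _ = + 0

-- [u v u' v'] : +1 at {u,v},{u',v'}; -1 at {v,u'},{v',u}; 0 elsewhere
-- (for distinct u,v,u',v' these four 2-subsets are distinct)
cyc : ∀ {n} → Fin n → Fin n → Fin n → Fin n → ZVec n
cyc u v u' v' e = ((isPair u v e + isPair u' v' e) - isPair v u' e) - isPair v' u e

Distinct4 : ∀ {n} → Fin n → Fin n → Fin n → Fin n → Set
Distinct4 u v u' v' =
  ¬ u ≡ v × ¬ u ≡ u' × ¬ u ≡ v' × ¬ v ≡ u' × ¬ v ≡ v' × ¬ u' ≡ v'

{-# OPTIONS --safe #-}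

-- Write E₁ − E₂ + E₃ − E₄ for the signed sum of the unit vectors of the edges of a walk
-- v₀ v₁ v₂ v₃ v₄.  Its vertex sums telescope to [w = v₀] − [w = v₄], so they vanish when the walk
-- closes up, and [u v u′ v′] is exactly this vector for the closed walk u v u′ v′.  Its row sum is
-- ±1 for each edge in the row, so if z u = z u′ the rows of E₁, E₂ and of E₃, E₄ agree and cancel
-- (if z v = z v′, those of E₁, E₄ and of E₂, E₃).
--
-- Conversely, let γ ∈ M_{n,z}.  At every vertex an edge of one sign is balanced by an edge of the
-- other sign, so from a positive edge {a, b} one walks x − c − a − b − d along edges of signs
-- +, −, +, −.  These four edges are distinct, so ‖γ‖₁ = 4 forces γ to be ±1 on them and 0
-- elsewhere.  The vertex sum at x then gives x = d, and the row sum in the row of {a, b} forces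
-- {c, a} or {b, x} into that row, i.e. z c = z b or z x = z a.

module Submission where

open import Defs
open import Data.Nat using (ℕ; zero; suc; z≤n)
open import Data.Nat.Properties using (n≢0⇒n>0)
open import Data.Fin as Fin using (Fin; zero; suc; punchIn)
open import Data.Fin.Patterns using (0F; 1F; 2F; 3F)
open import Data.Fin.Properties
  using (_≟_; _<?_; _≤?_; ≤-total; <-irrelevant; <-irrefl; <-asym; <-cmp; <⇒≢; punchInᵢ≢i; any?)
  renaming (≤-antisym to ≤-antisymᶠ)
open import Data.Integer using (ℤ; +_; -[1+_]; _+_; _-_; _*_; -_; ∣_∣; _≤_; _<_; +≤+; +<+)
open import Data.Integer.Properties
  using ( +-*-semiring; +-comm; +-identityʳ; +-inverseʳ; +-monoʳ-≤; +-monoˡ-≤; +-mono-≤; ≤-refl; ≤-antisym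
        ; ≮⇒≥; <⇒≱; *-identityˡ; *-identityʳ; *-comm; *-zeroʳ; 0≤i⇒+∣i∣≡i; ∣i∣≡0⇒i≡0; -1*i≡-i
        ; neg-mono-<; neg-cancel-<; i≡j⇒i-j≡0; i-j≡0⇒i≡j; module ≤-Reasoning )
import Data.Integer.Properties as ℤ
open import Data.Integer.Tactic.RingSolver using (solve-∀)
open import Algebra.Properties.Semiring.Sum +-*-semiring
  using (sum; sum-syntax; sum-cong-≗; sum-remove; sum-replicate-zero; ∑-distrib-+; *-distribˡ-sum)
open import Data.List using (allFin; map; tabulate)
open import Data.List.Properties using (map-tabulate)
open import Data.Vec.Functional using (removeAt; _∷_; [])
open import Data.Product using (Σ; ∃; ∃-syntax; _×_; _,_; proj₁; proj₂)
open import Data.Product.Properties using (≡-dec; ,-injective; ,-injectiveˡ; ,-injectiveʳ)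
open import Data.Sum using (_⊎_; inj₁; inj₂; [_,_]; [_,_]′)
open import Function using (_∘_; id; flip)
open import Function.Bundles using (_⇔_; mk⇔)
open import Function.Definitions using (Injective)
open import Relation.Nullary using (¬_; Dec; yes; no; contradiction)
open import Relation.Nullary.Decidable using (map′)
open import Relation.Binary.Definitions using (DecidableEquality; tri<; tri≈; tri>)
open import Relation.Binary.PropositionalEquality
  using (_≡_; _≢_; refl; sym; trans; cong; cong₂; subst; module ≡-Reasoning)

private
  variable
    m n k : ℕ
    w x y x′ y′ : Fin n
    e E E′ : Edge n

sum-zero : {t : Fin m → ℤ} → (∀ i → t i ≡ + 0) → sum t ≡ + 0
sum-zero {m} t≡0 = trans (sum-cong-≗ t≡0) (sum-replicate-zero m)

sum-single : (t : Fin m → ℤ) (i : Fin m) → (∀ j → j ≢ i → t j ≡ + 0) → sum t ≡ t i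
sum-single {suc m} t i t≡0 = begin
  sum t                     ≡⟨ sum-remove {i = i} t ⟩
  t i + sum (removeAt t i)  ≡⟨ cong (_+_ (t i)) (sum-zero λ j → t≡0 (punchIn i j) (punchInᵢ≢i i j)) ⟩
  t i + + 0                 ≡⟨ +-identityʳ (t i) ⟩
  t i                       ∎
  where open ≡-Reasoning

sum-nonneg : {t : Fin m → ℤ} → (∀ i → + 0 ≤ t i) → + 0 ≤ sum t
sum-nonneg {zero}  _   = ≤-refl
sum-nonneg {suc m} t≥0 = +-mono-≤ (t≥0 zero) (sum-nonneg (t≥0 ∘ suc))

term≤sum : (t : Fin m → ℤ) → (∀ i → + 0 ≤ t i) → ∀ i → t i ≤ sum t
term≤sum {suc m} t t≥0 i = begin
  t i                       ≡⟨ +-identityʳ (t i) ⟨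
  t i + + 0                 ≤⟨ +-monoʳ-≤ (t i) (sum-nonneg (t≥0 ∘ punchIn i)) ⟩
  t i + sum (removeAt t i)  ≡⟨ sum-remove {i = i} t ⟨
  sum t                     ∎
  where open ≤-Reasoning

-- Sums over the edges of Kₙ

pairValue : (Edge n → ℤ) → Fin n → Fin n → ℤ
pairValue f a b with a <? b
... | yes a<b = f (a , b , a<b)
... | no _    = + 0

sumℤ-allFin : (g h : Fin n → ℤ) → (∀ i → g i ≡ h i) → sumℤ (map g (allFin n)) ≡ sum h
sumℤ-allFin g h g≗h = trans (cong sumℤ (map-tabulate id g)) (tabulate-sum g h g≗h)
  where
  tabulate-sum : (g h : Fin m → ℤ) → (∀ i → g i ≡ h i) → sumℤ (tabulate g) ≡ sum h
  tabulate-sum {zero}  g h g≗h = refl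
  tabulate-sum {suc m} g h g≗h = cong₂ _+_ (g≗h zero) (tabulate-sum (g ∘ suc) (h ∘ suc) (g≗h ∘ suc))

-- The `_` is the summand in the `where` block of `edgeSum`, which cannot be named;
-- it is solved by the use in `edgeSum-∑∑`.
mutual
  summand≡pairValue : (f : Edge n → ℤ) (a b : Fin n) → _ ≡ pairValue f a b

  edgeSum-∑∑ : (f : Edge n → ℤ) → edgeSum f ≡ ∑[ a < n ] ∑[ b < n ] pairValue f a b
  edgeSum-∑∑ f = sumℤ-allFin _ _ λ a → sumℤ-allFin _ _ (summand≡pairValue f a)

  summand≡pairValue f a b with a <? b
  ... | yes _ = refl
  ... | no _  = refl

module _ (f : Edge n → ℤ) (a b : Fin n) where

  pairValue-edge : (a<b : a Fin.< b) → pairValue f a b ≡ f (a , b , a<b)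
  pairValue-edge a<b with a <? b
  ... | yes a<b′ = cong (λ p → f (a , b , p)) (<-irrelevant a<b′ a<b)
  ... | no a≮b   = contradiction a<b a≮b

  pairValue-zero : (∀ a<b → f (a , b , a<b) ≡ + 0) → pairValue f a b ≡ + 0
  pairValue-zero f≡0 with a <? b
  ... | yes a<b = f≡0 a<b
  ... | no _    = refl

  pairValue-nonneg : (∀ e → + 0 ≤ f e) → + 0 ≤ pairValue f a b
  pairValue-nonneg f≥0 with a <? b
  ... | yes _ = f≥0 _
  ... | no _  = ≤-refl

  pairValue-cong : {g : Edge n → ℤ} → (∀ e → f e ≡ g e) → pairValue f a b ≡ pairValue g a b
  pairValue-cong f≗g with a <? b
  ... | yes _ = f≗g _
  ... | no _  = refl

  pairValue-+ : (g : Edge n → ℤ) → pairValue (λ e → f e + g e) a b ≡ pairValue f a b + pairValue g a b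
  pairValue-+ g with a <? b
  ... | yes _ = refl
  ... | no _  = refl

  pairValue-* : ∀ c → pairValue (λ e → c * f e) a b ≡ c * pairValue f a b
  pairValue-* c with a <? b
  ... | yes _ = refl
  ... | no _  = sym (*-zeroʳ c)

edgeSum-cong : {f g : Edge n → ℤ} → (∀ e → f e ≡ g e) → edgeSum f ≡ edgeSum g
edgeSum-cong {n} {f} {g} f≗g = begin
  edgeSum f                              ≡⟨ edgeSum-∑∑ f ⟩
  ∑[ a < n ] ∑[ b < n ] pairValue f a b  ≡⟨ sum-cong-≗ (λ a → sum-cong-≗ λ b → pairValue-cong f a b f≗g) ⟩
  ∑[ a < n ] ∑[ b < n ] pairValue g a b  ≡⟨ edgeSum-∑∑ g ⟨
  edgeSum g                              ∎
  where open ≡-Reasoning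

edgeSum-+ : (f g : Edge n → ℤ) → edgeSum (λ e → f e + g e) ≡ edgeSum f + edgeSum g
edgeSum-+ {n} f g = begin
  edgeSum (λ e → f e + g e)
    ≡⟨ edgeSum-∑∑ (λ e → f e + g e) ⟩
  ∑[ a < n ] ∑[ b < n ] pairValue (λ e → f e + g e) a b
    ≡⟨ sum-cong-≗ (λ a → sum-cong-≗ λ b → pairValue-+ f a b g) ⟩
  ∑[ a < n ] ∑[ b < n ] (pairValue f a b + pairValue g a b)
    ≡⟨ sum-cong-≗ (λ a → ∑-distrib-+ (pairValue f a) (pairValue g a)) ⟩
  ∑[ a < n ] (∑[ b < n ] pairValue f a b + ∑[ b < n ] pairValue g a b)
    ≡⟨ ∑-distrib-+ (λ a → ∑[ b < n ] pairValue f a b) (λ a → ∑[ b < n ] pairValue g a b) ⟩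
  ∑[ a < n ] ∑[ b < n ] pairValue f a b + ∑[ a < n ] ∑[ b < n ] pairValue g a b
    ≡⟨ cong₂ _+_ (edgeSum-∑∑ f) (edgeSum-∑∑ g) ⟨
  edgeSum f + edgeSum g
    ∎
  where open ≡-Reasoning

edgeSum-* : (c : ℤ) (f : Edge n → ℤ) → edgeSum (λ e → c * f e) ≡ c * edgeSum f
edgeSum-* {n} c f = begin
  edgeSum (λ e → c * f e)
    ≡⟨ edgeSum-∑∑ (λ e → c * f e) ⟩
  ∑[ a < n ] ∑[ b < n ] pairValue (λ e → c * f e) a b
    ≡⟨ sum-cong-≗ (λ a → sum-cong-≗ λ b → pairValue-* f a b c) ⟩
  ∑[ a < n ] ∑[ b < n ] (c * pairValue f a b)
    ≡⟨ sum-cong-≗ (λ a → *-distribˡ-sum c (pairValue f a)) ⟨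
  ∑[ a < n ] (c * ∑[ b < n ] pairValue f a b)
    ≡⟨ *-distribˡ-sum c (λ a → ∑[ b < n ] pairValue f a b) ⟨
  c * ∑[ a < n ] ∑[ b < n ] pairValue f a b
    ≡⟨ cong (c *_) (edgeSum-∑∑ f) ⟨
  c * edgeSum f
    ∎
  where open ≡-Reasoning

edgeSum-neg : (f : Edge n → ℤ) → edgeSum (λ e → - f e) ≡ - edgeSum f
edgeSum-neg f = begin
  edgeSum (λ e → - f e)          ≡⟨ edgeSum-cong (λ e → -1*i≡-i (f e)) ⟨
  edgeSum (λ e → -[1+ 0 ] * f e) ≡⟨ edgeSum-* -[1+ 0 ] f ⟩
  -[1+ 0 ] * edgeSum f           ≡⟨ -1*i≡-i (edgeSum f) ⟩
  - edgeSum f                    ∎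
  where open ≡-Reasoning

edgeSum-zero : {f : Edge n → ℤ} → (∀ e → f e ≡ + 0) → edgeSum f ≡ + 0
edgeSum-zero {f = f} f≡0 =
  trans (edgeSum-∑∑ f) (sum-zero λ a → sum-zero λ b → pairValue-zero f a b λ _ → f≡0 _)

edgeSum-pointMass : {f : Edge n → ℤ} (E : Edge n) → (∀ e → e ≢ E → f e ≡ + 0) → edgeSum f ≡ f E
edgeSum-pointMass {n} {f} E@(a₀ , b₀ , a₀<b₀) f≡0 = begin
  edgeSum f                               ≡⟨ edgeSum-∑∑ f ⟩
  ∑[ a < n ] ∑[ b < n ] pairValue f a b
    ≡⟨ sum-single _ a₀ (λ a a≢a₀ → sum-zero λ b → pairValue-zero f a b λ _ → f≡0 _ (a≢a₀ ∘ cong proj₁)) ⟩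
  ∑[ b < n ] pairValue f a₀ b
    ≡⟨ sum-single _ b₀ (λ b b≢b₀ → pairValue-zero f a₀ b λ _ → f≡0 _ (b≢b₀ ∘ cong (proj₁ ∘ proj₂))) ⟩
  pairValue f a₀ b₀                       ≡⟨ pairValue-edge f a₀ b₀ a₀<b₀ ⟩
  f E                                     ∎
  where open ≡-Reasoning

edgeSum-term≤ : {f : Edge n → ℤ} → (∀ e → + 0 ≤ f e) → ∀ E → f E ≤ edgeSum f
edgeSum-term≤ {n} {f} f≥0 (a₀ , b₀ , a₀<b₀) = begin
  f (a₀ , b₀ , a₀<b₀)                     ≡⟨ pairValue-edge f a₀ b₀ a₀<b₀ ⟨
  pairValue f a₀ b₀                       ≤⟨ term≤sum _ (λ b → pairValue-nonneg f a₀ b f≥0) b₀ ⟩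
  ∑[ b < n ] pairValue f a₀ b             ≤⟨ term≤sum _ (λ a → sum-nonneg λ b → pairValue-nonneg f a b f≥0) a₀ ⟩
  ∑[ a < n ] ∑[ b < n ] pairValue f a b   ≡⟨ edgeSum-∑∑ f ⟨
  edgeSum f                               ∎
  where open ≤-Reasoning

edgeSum-nonneg : {f : Edge n → ℤ} → (∀ e → + 0 ≤ f e) → + 0 ≤ edgeSum f
edgeSum-nonneg {f = f} f≥0 =
  subst (+ 0 ≤_) (sym (edgeSum-∑∑ f)) (sum-nonneg λ a → sum-nonneg λ b → pairValue-nonneg f a b f≥0)

edgeSum-squeeze : {f g : Edge n → ℤ} → (∀ e → g e ≤ f e) → edgeSum f ≡ edgeSum g → ∀ e → f e ≡ g e
edgeSum-squeeze {f = f} {g} g≤f Σf≡Σg e =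
  i-j≡0⇒i≡j (f e) (g e) (≤-antisym (subst (f e - g e ≤_) Σ[f-g]≡0 (edgeSum-term≤ f-g≥0 e)) (f-g≥0 e))
  where
  f-g≥0 : ∀ e → + 0 ≤ f e - g e
  f-g≥0 e = subst (_≤ f e - g e) (+-inverseʳ (g e)) (+-monoˡ-≤ (- g e) (g≤f e))

  Σ[f-g]≡0 : edgeSum (λ e → f e - g e) ≡ + 0
  Σ[f-g]≡0 = begin
    edgeSum (λ e → f e - g e)          ≡⟨ edgeSum-+ f (λ e → - g e) ⟩
    edgeSum f + edgeSum (λ e → - g e)  ≡⟨ cong (_+_ (edgeSum f)) (edgeSum-neg g) ⟩
    edgeSum f - edgeSum g              ≡⟨ i≡j⇒i-j≡0 Σf≡Σg ⟩
    + 0                                ∎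
    where open ≡-Reasoning

any-edge? : {P : Edge n → Set} → (∀ e → Dec (P e)) → Dec (∃ P)
any-edge? {n} {P} P? =
  map′ (λ (a , b , a<b , p) → (a , b , a<b) , p) (λ ((a , b , a<b) , p) → a , b , a<b , p)
       (any? λ a → any? λ b → P-between? a b)
  where
  P-between? : (a b : Fin n) → Dec (Σ (a Fin.< b) λ a<b → P (a , b , a<b))
  P-between? a b with a <? b
  ... | no a≮b  = no (a≮b ∘ proj₁)
  ... | yes a<b = map′ (a<b ,_) (λ (a<b′ , p) → subst (λ q → P (a , b , q)) (<-irrelevant a<b′ a<b) p)
                       (P? (a , b , a<b))

zero-sum⇒negative : {f : Edge n → ℤ} {E : Edge n} → edgeSum f ≡ + 0 → + 0 < f E → ∃ λ e → f e < + 0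
zero-sum⇒negative {f = f} {E} Σf≡0 0<fE with any-edge? (λ e → f e ℤ.<? + 0)
... | yes neg = neg
... | no ¬neg = contradiction (subst (f E ≤_) Σf≡0 (edgeSum-term≤ (λ e → ≮⇒≥ (¬neg ∘ (e ,_))) E)) (<⇒≱ 0<fE)

zero-sum⇒positive : {f : Edge n → ℤ} {E : Edge n} → edgeSum f ≡ + 0 → f E < + 0 → ∃ λ e → + 0 < f e
zero-sum⇒positive {f = f} Σf≡0 fE<0 =
  let e , -fe<0 = zero-sum⇒negative {f = λ e → - f e} (trans (edgeSum-neg f) (cong -_ Σf≡0)) (neg-mono-< fE<0)
  in  e , neg-cancel-< -fe<0

-- Indicators, unit vectors and the endpoints of edges

𝟙 : {P : Set} → Dec P → ℤ
𝟙 (yes _) = + 1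
𝟙 (no _)  = + 0

module _ {P : Set} where

  𝟙-yes : P → (d : Dec P) → 𝟙 d ≡ + 1
  𝟙-yes _ (yes _) = refl
  𝟙-yes p (no ¬p) = contradiction p ¬p

  𝟙-no : ¬ P → (d : Dec P) → 𝟙 d ≡ + 0
  𝟙-no ¬p (yes p) = contradiction p ¬p
  𝟙-no _  (no _)  = refl

  𝟙≡1⇒ : (d : Dec P) → 𝟙 d ≡ + 1 → P
  𝟙≡1⇒ (yes p) _ = p

_≟ᴱ_ : DecidableEquality (Edge n)
_≟ᴱ_ = ≡-dec _≟_ (≡-dec _≟_ λ p q → yes (<-irrelevant p q))

δ : Edge n → ZVec n
δ E e = 𝟙 (E ≟ᴱ e)

data Joins {n} : Edge n → Fin n → Fin n → Set where
  forward  : ∀ {a b} (a<b : a Fin.< b) → Joins (a , b , a<b) a b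
  backward : ∀ {a b} (a<b : a Fin.< b) → Joins (a , b , a<b) b a

joins-sym : Joins E x y → Joins E y x
joins-sym (forward a<b)  = backward a<b
joins-sym (backward a<b) = forward a<b

joins-≢ : Joins E x y → x ≢ y
joins-≢ (forward a<b)  = <⇒≢ a<b
joins-≢ (backward a<b) = <⇒≢ a<b ∘ sym

joins-ends : Joins E x y → Joins E x′ y′ → (x ≡ x′ × y ≡ y′) ⊎ (x ≡ y′ × y ≡ x′)
joins-ends (forward _)  (forward _)  = inj₁ (refl , refl)
joins-ends (forward _)  (backward _) = inj₂ (refl , refl)
joins-ends (backward _) (forward _)  = inj₂ (refl , refl)
joins-ends (backward _) (backward _) = inj₁ (refl , refl)

joins-unique : Joins E x y → Joins E′ x y → E ≡ E′
joins-unique (forward p)  (forward q)  = cong (λ r → _ , _ , r) (<-irrelevant p q)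
joins-unique (forward p)  (backward q) = contradiction q (<-asym p)
joins-unique (backward p) (forward q)  = contradiction q (<-asym p)
joins-unique (backward p) (backward q) = cong (λ r → _ , _ , r) (<-irrelevant p q)

joins-≢-edge : Joins E x y → Joins E′ x′ y′ → (x ≢ x′ ⊎ y ≢ y′) → (x ≢ y′ ⊎ y ≢ x′) → E ≢ E′
joins-≢-edge J J′ straight crossed refl with joins-ends J J′
... | inj₁ (x≡x′ , y≡y′) = [ contradiction x≡x′ , contradiction y≡y′ ] straight
... | inj₂ (x≡y′ , y≡x′) = [ contradiction x≡y′ , contradiction y≡x′ ] crossed

edge-between : x ≢ y → ∃ λ E → Joins E x y
edge-between {x = x} {y} x≢y with <-cmp x y
... | tri< x<y _ _ = _ , forward x<y
... | tri≈ _ x≡y _ = contradiction x≡y x≢y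
... | tri> _ _ y<x = _ , backward y<x

joins⇒incident : Joins E w y → incident w E
joins⇒incident (forward _)  = inj₁ refl
joins⇒incident (backward _) = inj₂ refl

incident⇒joins : incident w E → ∃ λ y → Joins E w y
incident⇒joins {E = _ , _ , a<b} (inj₁ refl) = _ , forward a<b
incident⇒joins {E = _ , _ , a<b} (inj₂ refl) = _ , backward a<b

𝟙-incident : (w : Fin n) → Joins E x y → 𝟙 (incident? w E) ≡ 𝟙 (w ≟ x) + 𝟙 (w ≟ y)
𝟙-incident w (forward {a} {b} a<b) with w ≟ a | w ≟ b
... | yes refl | yes refl = contradiction a<b (<-irrefl refl)
... | yes _    | no _     = refl
... | no _     | yes _    = refl
... | no _     | no _     = refl
𝟙-incident w (backward {a} {b} a<b) = trans (𝟙-incident w (forward a<b)) (+-comm (𝟙 (w ≟ a)) (𝟙 (w ≟ b)))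

isPair-joins : Joins e x y → isPair x y e ≡ + 1
isPair-joins {x = x} {y} (forward _) with x ≟ x | y ≟ y | x ≟ y | y ≟ x
... | yes _   | yes _   | _ | _ = refl
... | no x≢x  | _       | _ | _ = contradiction refl x≢x
... | yes _   | no y≢y  | _ | _ = contradiction refl y≢y
isPair-joins {x = x} {y} (backward y<x) with y ≟ x | x ≟ y | y ≟ y | x ≟ x
... | yes y≡x | _ | _      | _      = contradiction y≡x (<⇒≢ y<x)
... | no _    | _ | yes _  | yes _  = refl
... | no _    | _ | no y≢y | _      = contradiction refl y≢y
... | no _    | _ | yes _  | no x≢x = contradiction refl x≢x

isPair-¬joins : ¬ Joins e x y → isPair x y e ≡ + 0
isPair-¬joins {e = a , b , a<b} {x} {y} ¬J with a ≟ x | b ≟ y | a ≟ y | b ≟ x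
... | yes refl | yes refl | _        | _        = contradiction (forward a<b) ¬J
... | no _     | _        | yes refl | yes refl = contradiction (backward a<b) ¬J
... | yes refl | no _     | yes refl | yes refl = contradiction (backward a<b) ¬J
... | no _     | _        | no _     | _        = refl
... | no _     | _        | yes _    | no _     = refl
... | yes _    | no _     | no _     | _        = refl
... | yes _    | no _     | yes _    | no _     = refl

isPair-δ : Joins E x y → ∀ e → isPair x y e ≡ δ E e
isPair-δ {E = E} J e with E ≟ᴱ e
... | yes refl = isPair-joins J
... | no E≢e   = isPair-¬joins (E≢e ∘ joins-unique J)

-- Rows of A_{n,z} and restricted sums

sorted : Fin k → Fin k → Fin k × Fin k
sorted p q = minF p q , maxF p q

module _ (p q : Fin k) where

  sorted-comm : sorted p q ≡ sorted q p
  sorted-comm with p ≤? q | q ≤? p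
  ... | yes p≤q | yes q≤p = let p≡q = ≤-antisymᶠ p≤q q≤p in cong₂ _,_ p≡q (sym p≡q)
  ... | yes _   | no _    = refl
  ... | no _    | yes _   = refl
  ... | no p≰q  | no q≰p  = contradiction (≤-total p q) [ p≰q , q≰p ]

  min≤max : minF p q Fin.≤ maxF p q
  min≤max with p ≤? q
  ... | yes p≤q = p≤q
  ... | no p≰q  = [ flip contradiction p≰q , id ]′ (≤-total p q)

sorted-cancelˡ : (p q r : Fin k) → sorted p q ≡ sorted p r → q ≡ r
sorted-cancelˡ p q r eq with p ≤? q | p ≤? r
... | yes _ | yes _ = ,-injectiveʳ eq
... | yes _ | no _  = let p≡r , q≡p = ,-injective eq in trans q≡p p≡r
... | no _  | yes _ = let q≡p , p≡r = ,-injective eq in trans q≡p p≡r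
... | no _  | no _  = ,-injectiveˡ eq

rowOf : (Fin n → Fin k) → Edge n → Fin k × Fin k
rowOf z (a , b , _) = sorted (z a) (z b)

module _ (z : Fin n → Fin k) where

  rowOf-joins : Joins E x y → rowOf z E ≡ sorted (z x) (z y)
  rowOf-joins (forward _)  = refl
  rowOf-joins (backward {a} {b} _) = sorted-comm (z a) (z b)

  rowOf-≡ : Joins E x y → Joins E′ x′ y′ → z x ≡ z x′ → z y ≡ z y′ → rowOf z E ≡ rowOf z E′
  rowOf-≡ J J′ zx≡zx′ zy≡zy′ =
    trans (rowOf-joins J) (trans (cong₂ sorted zx≡zx′ zy≡zy′) (sym (rowOf-joins J′)))

  rowOf-cancelˡ : Joins E x y → Joins E′ x y′ → rowOf z E ≡ rowOf z E′ → z y ≡ z y′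
  rowOf-cancelˡ {x = x} {y = y} {y′ = y′} J J′ eq =
    sorted-cancelˡ (z x) (z y) (z y′) (trans (sym (rowOf-joins J)) (trans eq (rowOf-joins J′)))

  inRow⇒rowOf : {i j : Fin k} → inRow z i j E → rowOf z E ≡ (i , j)
  inRow⇒rowOf {E = _ , _ , _} (refl , refl) = refl

  rowOf⇒inRow : {i j : Fin k} → rowOf z E ≡ (i , j) → inRow z i j E
  rowOf⇒inRow {E = _ , _ , _} refl = refl , refl

  𝟙-inRow : {i j : Fin k} (E E′ : Edge n) → rowOf z E ≡ rowOf z E′ → 𝟙 (inRow? z i j E) ≡ 𝟙 (inRow? z i j E′)
  𝟙-inRow {i} {j} E E′ eq with inRow? z i j E | inRow? z i j E′
  ... | yes _ | yes _ = refl
  ... | no _  | no _  = refl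
  ... | yes r | no ¬r′ = contradiction (rowOf⇒inRow {E = E′} (trans (sym eq) (inRow⇒rowOf {E = E} r))) ¬r′
  ... | no ¬r | yes r′ = contradiction (rowOf⇒inRow {E = E} (trans eq (inRow⇒rowOf {E = E′} r′))) ¬r

module _ {P : Edge n → Set} (P? : ∀ e → Dec (P e)) where

  restrict-≗ : (g : ZVec n) (e : Edge n) → restrict P P? g e ≡ 𝟙 (P? e) * g e
  restrict-≗ g e with P? e
  ... | yes _ = sym (*-identityˡ (g e))
  ... | no _  = refl

  restrict-yes : {g : ZVec n} → P e → restrict P P? g e ≡ g e
  restrict-yes {e = e} p with P? e
  ... | yes _ = refl
  ... | no ¬p = contradiction p ¬p

  restricted-entry : {g : ZVec n} {R : ℤ → Set} → R (restrict P P? g e) → ¬ R (+ 0) → P e × R (g e)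
  restricted-entry {e = e} r ¬R0 with P? e
  ... | yes p = p , r
  ... | no _  = contradiction r ¬R0

  restrictedSum-cong : {g g′ : ZVec n} → (∀ e → g e ≡ g′ e) → edgeSum (restrict P P? g) ≡ edgeSum (restrict P P? g′)
  restrictedSum-cong {g} {g′} g≗g′ = edgeSum-cong λ e →
    trans (restrict-≗ g e) (trans (cong (𝟙 (P? e) *_) (g≗g′ e)) (sym (restrict-≗ g′ e)))

vertexSum : Fin n → ZVec n → ℤ
vertexSum w γ = edgeSum (restrict (incident w) (incident? w) γ)

rowSum : (Fin n → Fin k) → Fin k → Fin k → ZVec n → ℤ
rowSum z i j γ = edgeSum (restrict (inRow z i j) (inRow? z i j) γ)

module _ {γ γ′ : ZVec n} (γ≗γ′ : ∀ e → γ e ≡ γ′ e) where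

  InKernel-cong : {z : Fin n → Fin k} → InKernel z γ → InKernel z γ′
  InKernel-cong {z = z} (balanced , row-balanced) =
    (λ w → trans (sym (restrictedSum-cong (incident? w) γ≗γ′)) (balanced w)) ,
    (λ i j i≤j → trans (sym (restrictedSum-cong (inRow? z i j) γ≗γ′)) (row-balanced i j i≤j))

  l1norm-cong : l1norm γ ≡ l1norm γ′
  l1norm-cong = cong ∣_∣ (edgeSum-cong λ e → cong (+_ ∘ ∣_∣) (γ≗γ′ e))

  InM-cong : {z : Fin n → Fin k} → InM z γ → InM z γ′
  InM-cong {z = z} (kernel , ‖γ‖≡4) = InKernel-cong {z = z} kernel , trans (sym l1norm-cong) ‖γ‖≡4

-- Integer combinations of unit vectors

δ-sum : edgeSum (δ E) ≡ + 1
δ-sum {E = E} = trans (edgeSum-pointMass E λ e e≢E → 𝟙-no (e≢E ∘ sym) (E ≟ᴱ e)) (𝟙-yes refl (E ≟ᴱ E))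

sum-ones : ∑[ i < m ] (+ 1) ≡ + m
sum-ones {zero}  = refl
sum-ones {suc m} = cong (_+_ (+ 1)) (sum-ones {m})

combination : (Fin m → Edge n) → (Fin m → ℤ) → ZVec n
combination {m} es cs e = ∑[ i < m ] (cs i * δ (es i) e)

module _ (es : Fin m → Edge n) where

  combination-at : (cs : Fin m → ℤ) → Injective _≡_ _≡_ es → ∀ i → combination es cs (es i) ≡ cs i
  combination-at cs es-inj i = begin
    ∑[ j < m ] (cs j * δ (es j) (es i))
      ≡⟨ sum-single _ i (λ j j≢i → trans (cong (cs j *_) (𝟙-no (j≢i ∘ es-inj) _)) (*-zeroʳ (cs j))) ⟩
    cs i * δ (es i) (es i)               ≡⟨ cong (cs i *_) (𝟙-yes refl _) ⟩
    cs i * + 1                           ≡⟨ *-identityʳ (cs i) ⟩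
    cs i                                 ∎
    where open ≡-Reasoning

  combination-outside : (cs : Fin m → ℤ) → (∀ i → es i ≢ e) → combination es cs e ≡ + 0
  combination-outside cs outside = sum-zero λ i → trans (cong (cs i *_) (𝟙-no (outside i) _)) (*-zeroʳ (cs i))

  combination-≗ : {cs : Fin m → ℤ} {f : ZVec n} → Injective _≡_ _≡_ es →
                  (∀ i → f (es i) ≡ cs i) → (∀ e → (∀ i → es i ≢ e) → f e ≡ + 0) →
                  ∀ e → f e ≡ combination es cs e
  combination-≗ {cs} es-inj f-at f-outside e with any? (λ i → es i ≟ᴱ e)
  ... | yes (i , refl) = trans (f-at i) (sym (combination-at cs es-inj i))
  ... | no ∄i          = trans (f-outside e outside) (sym (combination-outside cs outside))
    where
    outside : ∀ i → es i ≢ e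
    outside i esi≡e = ∄i (i , esi≡e)

edgeSum-combination : (es : Fin m → Edge n) (cs : Fin m → ℤ) → edgeSum (combination es cs) ≡ ∑[ i < m ] cs i
edgeSum-combination {zero}  es cs = edgeSum-zero {f = combination es cs} λ _ → refl
edgeSum-combination {suc m} es cs = begin
  edgeSum (combination es cs)
    ≡⟨ edgeSum-+ (λ e → cs zero * δ (es zero) e) (combination (es ∘ suc) (cs ∘ suc)) ⟩
  edgeSum (λ e → cs zero * δ (es zero) e) + edgeSum (combination (es ∘ suc) (cs ∘ suc))
    ≡⟨ cong₂ _+_ (edgeSum-* (cs zero) (δ (es zero))) (edgeSum-combination (es ∘ suc) (cs ∘ suc)) ⟩
  cs zero * edgeSum (δ (es zero)) + ∑[ i < m ] cs (suc i)
    ≡⟨ cong (λ t → cs zero * t + ∑[ i < m ] cs (suc i)) (δ-sum {E = es zero}) ⟩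
  cs zero * + 1 + ∑[ i < m ] cs (suc i)
    ≡⟨ cong (_+ ∑[ i < m ] cs (suc i)) (*-identityʳ (cs zero)) ⟩
  ∑[ i < suc m ] cs i
    ∎
  where open ≡-Reasoning

module _ {P : Edge n → Set} (P? : ∀ e → Dec (P e)) (es : Fin m → Edge n) (cs : Fin m → ℤ) where

  restrict-combination : ∀ e → restrict P P? (combination es cs) e ≡ combination es (λ i → cs i * 𝟙 (P? (es i))) e
  restrict-combination e = begin
    restrict P P? (combination es cs) e          ≡⟨ restrict-≗ P? (combination es cs) e ⟩
    𝟙 (P? e) * ∑[ i < m ] (cs i * δ (es i) e)    ≡⟨ *-distribˡ-sum (𝟙 (P? e)) (λ i → cs i * δ (es i) e) ⟩
    ∑[ i < m ] (𝟙 (P? e) * (cs i * δ (es i) e))  ≡⟨ sum-cong-≗ (λ i → indicator-to-edge (es i) (cs i)) ⟩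
    ∑[ i < m ] (cs i * 𝟙 (P? (es i)) * δ (es i) e) ∎
    where
    open ≡-Reasoning
    indicator-to-edge : ∀ E c → 𝟙 (P? e) * (c * δ E e) ≡ c * 𝟙 (P? E) * δ E e
    indicator-to-edge E c with E ≟ᴱ e
    ... | yes refl = trans (cong (𝟙 (P? E) *_) (*-identityʳ c)) (trans (*-comm (𝟙 (P? E)) c) (sym (*-identityʳ _)))
    ... | no _     = trans (cong (𝟙 (P? e) *_) (*-zeroʳ c)) (trans (*-zeroʳ (𝟙 (P? e))) (sym (*-zeroʳ (c * 𝟙 (P? E)))))

  restrictedSum-combination : edgeSum (restrict P P? (combination es cs)) ≡ ∑[ i < m ] (cs i * 𝟙 (P? (es i)))
  restrictedSum-combination =
    trans (edgeSum-cong restrict-combination) (edgeSum-combination es (λ i → cs i * 𝟙 (P? (es i))))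

l1norm-as-sum : (γ : ZVec n) → edgeSum (λ e → + ∣ γ e ∣) ≡ + l1norm γ
l1norm-as-sum γ = sym (0≤i⇒+∣i∣≡i (edgeSum-nonneg {f = λ e → + ∣ γ e ∣} λ e → +≤+ z≤n))

module _ {es : Fin m → Edge n} (es-inj : Injective _≡_ _≡_ es) where

  l1norm-combination : {cs : Fin m → ℤ} → (∀ i → ∣ cs i ∣ ≡ 1) → l1norm (combination es cs) ≡ m
  l1norm-combination {cs} ∣cs∣≡1 = cong ∣_∣ (begin
    edgeSum (λ e → + ∣ combination es cs e ∣)
      ≡⟨ edgeSum-cong (combination-≗ es {cs = λ _ → + 1} es-inj at outside) ⟩
    edgeSum (combination es (λ _ → + 1))
      ≡⟨ edgeSum-combination es (λ _ → + 1) ⟩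
    ∑[ i < m ] (+ 1)
      ≡⟨ sum-ones ⟩
    + m
      ∎)
    where
    open ≡-Reasoning
    at : ∀ i → + ∣ combination es cs (es i) ∣ ≡ + 1
    at i = trans (cong (+_ ∘ ∣_∣) (combination-at es cs es-inj i)) (cong +_ (∣cs∣≡1 i))
    outside : ∀ e → (∀ i → es i ≢ e) → + ∣ combination es cs e ∣ ≡ + 0
    outside e e∉es = cong (+_ ∘ ∣_∣) (combination-outside es cs e∉es)

  l1norm-squeeze : {γ : ZVec n} → (∀ i → γ (es i) ≢ + 0) → l1norm γ ≡ m →
                   ∀ e → + ∣ γ e ∣ ≡ combination es (λ _ → + 1) e
  l1norm-squeeze {γ} γ≢0 ‖γ‖≡m = edgeSum-squeeze below (begin
    edgeSum (λ e → + ∣ γ e ∣)              ≡⟨ l1norm-as-sum γ ⟩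
    + l1norm γ                             ≡⟨ cong +_ ‖γ‖≡m ⟩
    + m                                    ≡⟨ sum-ones ⟨
    ∑[ i < m ] (+ 1)                         ≡⟨ edgeSum-combination es (λ _ → + 1) ⟨
    edgeSum (combination es (λ _ → + 1))   ∎)
    where
    open ≡-Reasoning
    below : ∀ e → combination es (λ _ → + 1) e ≤ + ∣ γ e ∣
    below e with any? (λ i → es i ≟ᴱ e)
    ... | yes (i , refl) = subst (_≤ + ∣ γ (es i) ∣) (sym (combination-at es (λ _ → + 1) es-inj i))
                                 (+≤+ (n≢0⇒n>0 (γ≢0 i ∘ ∣i∣≡0⇒i≡0)))
    ... | no ∄i          = subst (_≤ + ∣ γ e ∣)
                                 (sym (combination-outside es (λ _ → + 1) λ i esi≡e → ∄i (i , esi≡e)))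
                                 (+≤+ z≤n)

-- Alternating sums along walks and 4-cycles

cong₄ : {A B C D R : Set} (f : A → B → C → D → R) {a a′ : A} {b b′ : B} {c c′ : C} {d d′ : D} →
        a ≡ a′ → b ≡ b′ → c ≡ c′ → d ≡ d′ → f a b c d ≡ f a′ b′ c′ d′
cong₄ f refl refl refl refl = refl

alternatingSigns : Fin 4 → ℤ
alternatingSigns = + 1 ∷ -[1+ 0 ] ∷ + 1 ∷ -[1+ 0 ] ∷ []

alternating : (E₁ E₂ E₃ E₄ : Edge n) → ZVec n
alternating E₁ E₂ E₃ E₄ = combination (E₁ ∷ E₂ ∷ E₃ ∷ E₄ ∷ []) alternatingSigns

module _ {E₁ E₂ E₃ E₄ : Edge n} where

  injective₄ : E₁ ≢ E₂ → E₁ ≢ E₃ → E₁ ≢ E₄ → E₂ ≢ E₃ → E₂ ≢ E₄ → E₃ ≢ E₄ →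
               Injective _≡_ _≡_ (E₁ ∷ E₂ ∷ E₃ ∷ E₄ ∷ [])
  injective₄ d₁₂ d₁₃ d₁₄ d₂₃ d₂₄ d₃₄ {0F} {0F} _ = refl
  injective₄ d₁₂ d₁₃ d₁₄ d₂₃ d₂₄ d₃₄ {0F} {1F} eq = contradiction eq d₁₂
  injective₄ d₁₂ d₁₃ d₁₄ d₂₃ d₂₄ d₃₄ {0F} {2F} eq = contradiction eq d₁₃
  injective₄ d₁₂ d₁₃ d₁₄ d₂₃ d₂₄ d₃₄ {0F} {3F} eq = contradiction eq d₁₄
  injective₄ d₁₂ d₁₃ d₁₄ d₂₃ d₂₄ d₃₄ {1F} {0F} eq = contradiction (sym eq) d₁₂
  injective₄ d₁₂ d₁₃ d₁₄ d₂₃ d₂₄ d₃₄ {1F} {1F} _ = refl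
  injective₄ d₁₂ d₁₃ d₁₄ d₂₃ d₂₄ d₃₄ {1F} {2F} eq = contradiction eq d₂₃
  injective₄ d₁₂ d₁₃ d₁₄ d₂₃ d₂₄ d₃₄ {1F} {3F} eq = contradiction eq d₂₄
  injective₄ d₁₂ d₁₃ d₁₄ d₂₃ d₂₄ d₃₄ {2F} {0F} eq = contradiction (sym eq) d₁₃
  injective₄ d₁₂ d₁₃ d₁₄ d₂₃ d₂₄ d₃₄ {2F} {1F} eq = contradiction (sym eq) d₂₃
  injective₄ d₁₂ d₁₃ d₁₄ d₂₃ d₂₄ d₃₄ {2F} {2F} _ = refl
  injective₄ d₁₂ d₁₃ d₁₄ d₂₃ d₂₄ d₃₄ {2F} {3F} eq = contradiction eq d₃₄
  injective₄ d₁₂ d₁₃ d₁₄ d₂₃ d₂₄ d₃₄ {3F} {0F} eq = contradiction (sym eq) d₁₄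
  injective₄ d₁₂ d₁₃ d₁₄ d₂₃ d₂₄ d₃₄ {3F} {1F} eq = contradiction (sym eq) d₂₄
  injective₄ d₁₂ d₁₃ d₁₄ d₂₃ d₂₄ d₃₄ {3F} {2F} eq = contradiction (sym eq) d₃₄
  injective₄ d₁₂ d₁₃ d₁₄ d₂₃ d₂₄ d₃₄ {3F} {3F} _ = refl


  restrictedSum-alternating : {P : Edge n → Set} (P? : ∀ e → Dec (P e)) →
    edgeSum (restrict P P? (alternating E₁ E₂ E₃ E₄)) ≡ 𝟙 (P? E₁) - 𝟙 (P? E₂) + 𝟙 (P? E₃) - 𝟙 (P? E₄)
  restrictedSum-alternating P? =
    trans (restrictedSum-combination P? (E₁ ∷ E₂ ∷ E₃ ∷ E₄ ∷ []) alternatingSigns)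
          (signed-sum (𝟙 (P? E₁)) (𝟙 (P? E₂)) (𝟙 (P? E₃)) (𝟙 (P? E₄)))
    where
    signed-sum : ∀ a b c d → + 1 * a + (-[1+ 0 ] * b + (+ 1 * c + (-[1+ 0 ] * d + + 0))) ≡ a - b + c - d
    signed-sum = solve-∀

  module _ {v₀ v₁ v₂ v₃ v₄ : Fin n} (J₁ : Joins E₁ v₀ v₁) (J₂ : Joins E₂ v₁ v₂)
                                   (J₃ : Joins E₃ v₂ v₃) (J₄ : Joins E₄ v₃ v₄) where

    walk-vertexSum : ∀ w → vertexSum w (alternating E₁ E₂ E₃ E₄) ≡ 𝟙 (w ≟ v₀) - 𝟙 (w ≟ v₄)
    walk-vertexSum w = begin
      vertexSum w (alternating E₁ E₂ E₃ E₄)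
        ≡⟨ restrictedSum-alternating (incident? w) ⟩
      𝟙 (incident? w E₁) - 𝟙 (incident? w E₂) + 𝟙 (incident? w E₃) - 𝟙 (incident? w E₄)
        ≡⟨ cong₄ (λ a b c d → a - b + c - d)
                 (𝟙-incident w J₁) (𝟙-incident w J₂) (𝟙-incident w J₃) (𝟙-incident w J₄) ⟩
      (𝟙 (w ≟ v₀) + 𝟙 (w ≟ v₁)) - (𝟙 (w ≟ v₁) + 𝟙 (w ≟ v₂))
        + (𝟙 (w ≟ v₂) + 𝟙 (w ≟ v₃)) - (𝟙 (w ≟ v₃) + 𝟙 (w ≟ v₄))
        ≡⟨ telescope (𝟙 (w ≟ v₀)) (𝟙 (w ≟ v₁)) (𝟙 (w ≟ v₂)) (𝟙 (w ≟ v₃)) (𝟙 (w ≟ v₄)) ⟩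
      𝟙 (w ≟ v₀) - 𝟙 (w ≟ v₄)
        ∎
      where
      open ≡-Reasoning
      telescope : ∀ a b c d e → (a + b) - (b + c) + (c + d) - (d + e) ≡ a - e
      telescope = solve-∀

    walk-closes : vertexSum v₀ (alternating E₁ E₂ E₃ E₄) ≡ + 0 → v₀ ≡ v₄
    walk-closes balanced = 𝟙≡1⇒ (v₀ ≟ v₄) (sym (i-j≡0⇒i≡j (+ 1) (𝟙 (v₀ ≟ v₄)) (begin
      + 1 - 𝟙 (v₀ ≟ v₄)                      ≡⟨ cong (_- 𝟙 (v₀ ≟ v₄)) (𝟙-yes refl (v₀ ≟ v₀)) ⟨
      𝟙 (v₀ ≟ v₀) - 𝟙 (v₀ ≟ v₄)              ≡⟨ walk-vertexSum v₀ ⟨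
      vertexSum v₀ (alternating E₁ E₂ E₃ E₄)  ≡⟨ balanced ⟩
      + 0                                     ∎)))
      where open ≡-Reasoning

  module _ {u v u′ v′ : Fin n}
           (J₁ : Joins E₁ u v) (J₂ : Joins E₂ v u′) (J₃ : Joins E₃ u′ v′) (J₄ : Joins E₄ v′ u) where

    cyc≗alternating : ∀ e → cyc u v u′ v′ e ≡ alternating E₁ E₂ E₃ E₄ e
    cyc≗alternating e = begin
      cyc u v u′ v′ e
        ≡⟨ cong₄ (λ a b c d → a + c - b - d) (isPair-δ J₁ e) (isPair-δ J₂ e) (isPair-δ J₃ e) (isPair-δ J₄ e) ⟩
      δ E₁ e + δ E₃ e - δ E₂ e - δ E₄ e
        ≡⟨ rearrange (δ E₁ e) (δ E₂ e) (δ E₃ e) (δ E₄ e) ⟩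
      alternating E₁ E₂ E₃ E₄ e
        ∎
      where
      open ≡-Reasoning
      rearrange : ∀ a b c d → a + c - b - d ≡ + 1 * a + (-[1+ 0 ] * b + (+ 1 * c + (-[1+ 0 ] * d + + 0)))
      rearrange = solve-∀

    cycle-injective : Distinct4 u v u′ v′ → Injective _≡_ _≡_ (E₁ ∷ E₂ ∷ E₃ ∷ E₄ ∷ [])
    cycle-injective (u≢v , u≢u′ , u≢v′ , v≢u′ , v≢v′ , u′≢v′) = injective₄
      (joins-≢-edge J₁ J₂ (inj₁ u≢v) (inj₁ u≢u′))
      (joins-≢-edge J₁ J₃ (inj₁ u≢u′) (inj₁ u≢v′))
      (joins-≢-edge J₁ J₄ (inj₁ u≢v′) (inj₂ v≢v′))
      (joins-≢-edge J₂ J₃ (inj₁ v≢u′) (inj₁ v≢v′))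
      (joins-≢-edge J₂ J₄ (inj₁ v≢v′) (inj₁ (u≢v ∘ sym)))
      (joins-≢-edge J₃ J₄ (inj₁ u′≢v′) (inj₁ (u≢u′ ∘ sym)))

    cycle-balanced : ∀ w → vertexSum w (alternating E₁ E₂ E₃ E₄) ≡ + 0
    cycle-balanced w = trans (walk-vertexSum J₁ J₂ J₃ J₄ w) (+-inverseʳ (𝟙 (w ≟ u)))

    module _ (z : Fin n → Fin k) (i j : Fin k) where

      private
        r : Edge n → ℤ
        r E = 𝟙 (inRow? z i j E)

      cycle-rowSum : z u ≡ z u′ ⊎ z v ≡ z v′ → rowSum z i j (alternating E₁ E₂ E₃ E₄) ≡ + 0
      cycle-rowSum z-condition = trans (restrictedSum-alternating (inRow? z i j)) (cancel z-condition)
        where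
        cancel : z u ≡ z u′ ⊎ z v ≡ z v′ → r E₁ - r E₂ + r E₃ - r E₄ ≡ + 0
        cancel (inj₁ zu≡zu′) = begin
          r E₁ - r E₂ + r E₃ - r E₄
            ≡⟨ cong₂ (λ a b → r E₁ - a + r E₃ - b) (𝟙-inRow z E₁ E₂ R₁≡R₂) (𝟙-inRow z E₃ E₄ R₃≡R₄) ⟨
          r E₁ - r E₁ + r E₃ - r E₃  ≡⟨ pairs-cancel (r E₁) (r E₃) ⟩
          + 0                        ∎
          where
          open ≡-Reasoning
          R₁≡R₂ : rowOf z E₁ ≡ rowOf z E₂
          R₁≡R₂ = rowOf-≡ z J₁ (joins-sym J₂) zu≡zu′ refl
          R₃≡R₄ : rowOf z E₃ ≡ rowOf z E₄
          R₃≡R₄ = rowOf-≡ z J₃ (joins-sym J₄) (sym zu≡zu′) refl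
          pairs-cancel : ∀ a b → a - a + b - b ≡ + 0
          pairs-cancel = solve-∀
        cancel (inj₂ zv≡zv′) = begin
          r E₁ - r E₂ + r E₃ - r E₄
            ≡⟨ cong₂ (λ a b → r E₁ - a + r E₃ - b) (𝟙-inRow z E₃ E₂ (sym R₂≡R₃)) (𝟙-inRow z E₁ E₄ R₁≡R₄) ⟨
          r E₁ - r E₃ + r E₃ - r E₁  ≡⟨ pairs-cancel (r E₁) (r E₃) ⟩
          + 0                        ∎
          where
          open ≡-Reasoning
          R₁≡R₄ : rowOf z E₁ ≡ rowOf z E₄
          R₁≡R₄ = rowOf-≡ z J₁ (joins-sym J₄) refl zv≡zv′
          R₂≡R₃ : rowOf z E₂ ≡ rowOf z E₃
          R₂≡R₃ = rowOf-≡ z J₂ (joins-sym J₃) zv≡zv′ refl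
          pairs-cancel : ∀ a b → a - b + b - a ≡ + 0
          pairs-cancel = solve-∀

      cycle-rowSum-converse : rowSum z i j (alternating E₁ E₂ E₃ E₄) ≡ + 0 → inRow z i j E₃ →
                              z u ≡ z u′ ⊎ z v ≡ z v′
      cycle-rowSum-converse row-balanced r₃ =
        neighbour-in-row (inRow? z i j E₂) (inRow? z i j E₄)
          (trans (sym (restrictedSum-alternating (inRow? z i j))) row-balanced)
        where
        R₃ : rowOf z E₃ ≡ (i , j)
        R₃ = inRow⇒rowOf z {E = E₃} r₃
        neighbour-in-row : (d₂ : Dec (inRow z i j E₂)) (d₄ : Dec (inRow z i j E₄)) →
                           r E₁ - 𝟙 d₂ + r E₃ - 𝟙 d₄ ≡ + 0 → z u ≡ z u′ ⊎ z v ≡ z v′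
        neighbour-in-row (yes r₂) _ _ =
          inj₂ (rowOf-cancelˡ z (joins-sym J₂) J₃ (trans (inRow⇒rowOf z {E = E₂} r₂) (sym R₃)))
        neighbour-in-row (no _) (yes r₄) _ =
          inj₁ (rowOf-cancelˡ z J₄ (joins-sym J₃) (trans (inRow⇒rowOf z {E = E₄} r₄) (sym R₃)))
        neighbour-in-row (no _)   (no _)   sum≡0 =
          contradiction (subst (λ t → r E₁ - + 0 + t - + 0 ≡ + 0) (𝟙-yes r₃ (inRow? z i j E₃)) sum≡0)
                        (positive (inRow? z i j E₁))
          where
          positive : {P : Set} (d : Dec P) → 𝟙 d - + 0 + + 1 - + 0 ≢ + 0
          positive (yes _) ()
          positive (no _)  ()

    cycle-InM : {z : Fin n → Fin k} → Distinct4 u v u′ v′ → z u ≡ z u′ ⊎ z v ≡ z v′ →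
                InM z (alternating E₁ E₂ E₃ E₄)
    cycle-InM {z = z} distinct z-condition =
      (cycle-balanced , λ i j _ → cycle-rowSum z i j z-condition) ,
      l1norm-combination (cycle-injective distinct) {cs = alternatingSigns}
        λ where 0F → refl; 1F → refl; 2F → refl; 3F → refl

-- Sign-alternating walks in kernel vectors

module _ {γ : ZVec n} (balanced : vertexSum w γ ≡ + 0) (J : Joins E w y) where

  private
    γ|E≡γE : restrict (incident w) (incident? w) γ E ≡ γ E
    γ|E≡γE = restrict-yes (incident? w) (joins⇒incident J)

  negative-neighbour : + 0 < γ E → ∃[ e ] ∃[ y′ ] (Joins e w y′ × γ e < + 0)
  negative-neighbour γE>0 =
    let e , γ|e<0  = zero-sum⇒negative {E = E} balanced (subst (+ 0 <_) (sym γ|E≡γE) γE>0)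
        w∈e , γe<0 = restricted-entry (incident? w) {g = γ} {R = _< + 0} γ|e<0 (ℤ.<-irrefl refl)
        y′ , J′    = incident⇒joins w∈e
    in  e , y′ , J′ , γe<0

  positive-neighbour : γ E < + 0 → ∃[ e ] ∃[ y′ ] (Joins e w y′ × + 0 < γ e)
  positive-neighbour γE<0 =
    let e , γ|e>0  = zero-sum⇒positive {E = E} balanced (subst (_< + 0) (sym γ|E≡γE) γE<0)
        w∈e , γe>0 = restricted-entry (incident? w) {g = γ} {R = + 0 <_} γ|e>0 (ℤ.<-irrefl refl)
        y′ , J′    = incident⇒joins w∈e
    in  e , y′ , J′ , γe>0

l1norm-zero : {γ : ZVec n} → (∀ e → γ e ≡ + 0) → l1norm γ ≡ 0
l1norm-zero {γ = γ} γ≡0 = cong ∣_∣ (edgeSum-zero {f = λ e → + ∣ γ e ∣} λ e → cong (+_ ∘ ∣_∣) (γ≡0 e))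

positive-entry : {γ : ZVec n} → (∀ w → vertexSum w γ ≡ + 0) → l1norm γ ≢ 0 → ∃ λ e → + 0 < γ e
positive-entry {γ = γ} balanced ‖γ‖≢0 with any-edge? (λ e → + 0 ℤ.<? γ e) | any-edge? (λ e → γ e ℤ.<? + 0)
... | yes pos | _ = pos
... | no _    | yes ((a , _ , a<b) , γE<0) =
  let e , _ , _ , γe>0 = positive-neighbour (balanced a) (forward a<b) γE<0 in e , γe>0
... | no ¬pos | no ¬neg =
  contradiction (l1norm-zero λ e → ≤-antisym (≮⇒≥ (¬pos ∘ (e ,_))) (≮⇒≥ (¬neg ∘ (e ,_)))) ‖γ‖≢0

Is4Cycle : (Fin n → Fin k) → ZVec n → Set
Is4Cycle {n} z γ =
  ∃[ u ] ∃[ v ] ∃[ u′ ] ∃[ v′ ]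
    (Distinct4 u v u′ v′ × (z u ≡ z u′ ⊎ z v ≡ z v′) × ((e : Edge n) → γ e ≡ cyc u v u′ v′ e))

record SignAlternatingWalk (γ : ZVec n) : Set where
  field
    v₀ v₁ v₂ v₃ v₄ : Fin n
    E₁ E₂ E₃ E₄    : Edge n
    J₁ : Joins E₁ v₀ v₁
    J₂ : Joins E₂ v₁ v₂
    J₃ : Joins E₃ v₂ v₃
    J₄ : Joins E₄ v₃ v₄
    γE₁>0 : + 0 < γ E₁
    γE₂<0 : γ E₂ < + 0
    γE₃>0 : + 0 < γ E₃
    γE₄<0 : γ E₄ < + 0

sign-alternating-walk : {γ : ZVec n} → (∀ w → vertexSum w γ ≡ + 0) → l1norm γ ≢ 0 → SignAlternatingWalk γ
sign-alternating-walk balanced ‖γ‖≢0 =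
  let (a , b , a<b) , γab>0 = positive-entry balanced ‖γ‖≢0
      _ , c , Jac , γac<0 = negative-neighbour (balanced a) (forward a<b) γab>0
      _ , _ , Jbd , γbd<0 = negative-neighbour (balanced b) (backward a<b) γab>0
      _ , _ , Jcx , γcx>0 = positive-neighbour (balanced c) (joins-sym Jac) γac<0
  in  record
        { J₁ = joins-sym Jcx ; J₂ = joins-sym Jac ; J₃ = forward a<b ; J₄ = Jbd
        ; γE₁>0 = γcx>0 ; γE₂<0 = γac<0 ; γE₃>0 = γab>0 ; γE₄<0 = γbd<0
        }

pos-unit : {x : ℤ} → + 0 < x → ∣ x ∣ ≡ 1 → x ≡ + 1
pos-unit {+ _} _ refl = refl

neg-unit : {x : ℤ} → x < + 0 → ∣ x ∣ ≡ 1 → x ≡ -[1+ 0 ]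
neg-unit { -[1+ _ ]} _ refl = refl
neg-unit {+ _}      (+<+ ()) _

opposite-signs⇒≢ : (γ : ZVec n) → + 0 < γ E → γ E′ < + 0 → E ≢ E′
opposite-signs⇒≢ _ γE>0 γE′<0 refl = ℤ.<-asym γE>0 γE′<0

module SignAlternatingWalkProperties {γ : ZVec n} (W : SignAlternatingWalk γ) where

  open SignAlternatingWalk W

  edges : Fin 4 → Edge n
  edges = E₁ ∷ E₂ ∷ E₃ ∷ E₄ ∷ []

  E₁≢E₂ : E₁ ≢ E₂
  E₁≢E₂ = opposite-signs⇒≢ γ γE₁>0 γE₂<0

  v₁≢v₃ : v₁ ≢ v₃
  v₁≢v₃ v₁≡v₃ =
    opposite-signs⇒≢ γ γE₃>0 γE₂<0 (joins-unique J₃ (subst (Joins E₂ v₂) v₁≡v₃ (joins-sym J₂)))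

  edges-injective : Injective _≡_ _≡_ edges
  edges-injective = injective₄
    E₁≢E₂
    (joins-≢-edge J₁ J₃ (inj₂ v₁≢v₃) (inj₂ (joins-≢ J₂)))
    (opposite-signs⇒≢ γ γE₁>0 γE₄<0)
    (opposite-signs⇒≢ γ γE₃>0 γE₂<0 ∘ sym)
    (joins-≢-edge J₂ J₄ (inj₁ v₁≢v₃) (inj₂ (joins-≢ J₃)))
    (opposite-signs⇒≢ γ γE₃>0 γE₄<0)

  γ≗alternating : l1norm γ ≡ 4 → ∀ e → γ e ≡ alternating E₁ E₂ E₃ E₄ e
  γ≗alternating ‖γ‖≡4 = combination-≗ edges {cs = alternatingSigns} {f = γ} edges-injective at outside
    where
    nonzero : ∀ i → γ (edges i) ≢ + 0
    nonzero 0F = ℤ.<⇒≢ γE₁>0 ∘ sym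
    nonzero 1F = ℤ.<⇒≢ γE₂<0
    nonzero 2F = ℤ.<⇒≢ γE₃>0 ∘ sym
    nonzero 3F = ℤ.<⇒≢ γE₄<0

    squeeze : ∀ e → + ∣ γ e ∣ ≡ combination edges (λ _ → + 1) e
    squeeze = l1norm-squeeze edges-injective {γ = γ} nonzero ‖γ‖≡4

    unit : ∀ i → ∣ γ (edges i) ∣ ≡ 1
    unit i = ℤ.+-injective (trans (squeeze (edges i)) (combination-at edges (λ _ → + 1) edges-injective i))

    at : ∀ i → γ (edges i) ≡ alternatingSigns i
    at 0F = pos-unit γE₁>0 (unit 0F)
    at 1F = neg-unit γE₂<0 (unit 1F)
    at 2F = pos-unit γE₃>0 (unit 2F)
    at 3F = neg-unit γE₄<0 (unit 3F)

    outside : ∀ e → (∀ i → edges i ≢ e) → γ e ≡ + 0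
    outside e e∉edges =
      ∣i∣≡0⇒i≡0 (ℤ.+-injective (trans (squeeze e) (combination-outside edges (λ _ → + 1) e∉edges)))

  module _ (v₀≡v₄ : v₀ ≡ v₄) where

    J₄′ : Joins E₄ v₃ v₀
    J₄′ = subst (Joins E₄ v₃) (sym v₀≡v₄) J₄

    distinct : Distinct4 v₀ v₁ v₂ v₃
    distinct = joins-≢ J₁ , v₀≢v₂ , joins-≢ (joins-sym J₄′) , joins-≢ J₂ , v₁≢v₃ , joins-≢ J₃
      where
      v₀≢v₂ : v₀ ≢ v₂
      v₀≢v₂ v₀≡v₂ = E₁≢E₂ (joins-unique (subst (λ t → Joins E₁ t v₁) v₀≡v₂ J₁) (joins-sym J₂))

  closes-into-cyc : {z : Fin n → Fin k} → InM z γ → Is4Cycle z γ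
  closes-into-cyc {k = k} {z = z} (kernel , ‖γ‖≡4) = v₀ , v₁ , v₂ , v₃ , distinct closed , z-condition , γ≗cyc
    where
    γ≗alt : ∀ e → γ e ≡ alternating E₁ E₂ E₃ E₄ e
    γ≗alt = γ≗alternating ‖γ‖≡4

    kernel′ : InKernel z (alternating E₁ E₂ E₃ E₄)
    kernel′ = InKernel-cong γ≗alt {z = z} kernel

    closed : v₀ ≡ v₄
    closed = walk-closes J₁ J₂ J₃ J₄ (proj₁ kernel′ v₀)

    i j : Fin k
    i = proj₁ (rowOf z E₃)
    j = proj₂ (rowOf z E₃)

    z-condition : z v₀ ≡ z v₂ ⊎ z v₁ ≡ z v₃
    z-condition = cycle-rowSum-converse J₁ J₂ J₃ (J₄′ closed) z i j
      (proj₂ kernel′ i j (min≤max (z (proj₁ E₃)) (z (proj₁ (proj₂ E₃)))))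
      (rowOf⇒inRow z {E = E₃} refl)

    γ≗cyc : ∀ e → γ e ≡ cyc v₀ v₁ v₂ v₃ e
    γ≗cyc e = trans (γ≗alt e) (sym (cyc≗alternating J₁ J₂ J₃ (J₄′ closed) e))

InM⇒cyc : {z : Fin n → Fin k} {γ : ZVec n} → InM z γ → Is4Cycle z γ
InM⇒cyc {γ = γ} inM@((balanced , _) , ‖γ‖≡4) =
  SignAlternatingWalkProperties.closes-into-cyc (sign-alternating-walk balanced ‖γ‖≢0) inM
  where
  ‖γ‖≢0 : l1norm γ ≢ 0
  ‖γ‖≢0 ‖γ‖≡0 = contradiction (trans (sym ‖γ‖≡4) ‖γ‖≡0) λ ()

cyc⇒InM : {z : Fin n → Fin k} {γ : ZVec n} → Is4Cycle z γ → InM z γ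
cyc⇒InM {z = z} (u , v , u′ , v′ , distinct@(u≢v , _ , u≢v′ , v≢u′ , _ , u′≢v′) , z-condition , γ≗cyc)
  with edge-between u≢v | edge-between v≢u′ | edge-between u′≢v′ | edge-between (u≢v′ ∘ sym)
... | E₁ , J₁ | E₂ , J₂ | E₃ , J₃ | E₄ , J₄ =
  InM-cong (λ e → sym (trans (γ≗cyc e) (cyc≗alternating J₁ J₂ J₃ J₄ e))) {z = z}
           (cycle-InM J₁ J₂ J₃ J₄ {z = z} distinct z-condition)

lemma2p1 : (n k : ℕ) (z : Fin n → Fin k) (γ : ZVec n) →
    InM z γ ⇔
      (∃[ u ] ∃[ v ] ∃[ u' ] ∃[ v' ]
        (Distinct4 u v u' v' × ((z u ≡ z u') ⊎ (z v ≡ z v'))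
          × ((e : Edge n) → γ e ≡ cyc u v u' v' e)))
lemma2p1 n k z γ = mk⇔ InM⇒cyc cyc⇒InM
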